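{- Let $\mathbf 3$ be the structure with universe $\{0,1,2\}$ in which each of the three elements is named by a constant symbol. Then the algebra $\mathrm{Cs}_{\mathrm{IFG}_1}(\mathbf 3)$ is not hereditarily simple: it has a subalgebra with a congruence that is neither the identity relation nor the total relation.
   Context: Teams and operations. For a set $A$ and $N\in\mathbb N$ (identify $N$ with $\{0,\dots,N-1\}$), ${}^NA$ is the set of valuations $\vec a=(a_0,\dots,a_{N-1})$; a team is a subset of ${}^NA$ (for $N=1$ identify ${}^1A$ with $A$). For $J\subseteq N$, $\vec a\approx_J\vec b$ means they agree on $N\setminus J$. $V=V_1\cup_J V_2$ means $V_1\cup V_2=V$, $V_1\cap V_2=\emptyset$, and each $V_i$ is closed under $\approx_J$ within $V$. $f:V\to A$ is independent of $J$ if $f(\vec a)=f(\vec b)$ whenever $\vec a\approx_J\vec b$. $\vec a(n:b)$ is $\vec a$ with $n$th coordinate replaced by $b$; $V(n:f)=\{\vec a(n:f(\vec a)):\vec a\in V\}$; $W(n:A)=\{\vec a(n:b):\vec a\in W,b\in A\}$. The IFG-cylindric power set algebra with base set $A$ and dimension $N$ has universe $\mathcal P(\mathcal P({}^NA))\times\mathcal P(\mathcal P({}^NA))$, elements written $X=\langle X^+,X^-\rangle$, and operations: $0=\langle\{\emptyset\},\mathcal P({}^NA)\rangle$, $1=\langle\mathcal P({}^NA),\{\emptyset\}\rangle$, $D_{ij}=\langle\mathcal P(\{\vec a:a_i=a_j\}),\mathcal P(\{\vec a:a_i\neq a_j\})\rangle$ ($i,j<N$); $\neg X=\langle X^-,X^+\rangle$;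 for $J\subseteq N$: $(X+_JY)^+=\{V:V=V_1\cup_JV_2,\ V_1\in X^+,V_2\in Y^+\}$, $(X+_JY)^-=X^-\cap Y^-$; $(X\cdot_JY)^+=X^+\cap Y^+$, $(X\cdot_JY)^-=\{W:W=W_1\cup_JW_2,\ W_1\in X^-,W_2\in Y^-\}$; for $n<N$, $J\subseteq N$: $C_{n,J}(X)^+=\{V:V(n:f)\in X^+$ for some $f:V\to A$ independent of $J\}$, $C_{n,J}(X)^-=\{W:W(n:A)\in X^-\}$. IFG$_N$-formulas in variables $v_0,\dots,v_{N-1}$ are built from atomic first-order formulas by $\sim\phi$, $\phi\vee_{/J}\psi$ and $(\exists v_n/J)\phi$ ($J\subseteq N$, $n<N$). For a structure $\mathfrak A$ with universe $A$, $\mathfrak A\models^+\phi[V]$ and $\mathfrak A\models^-\phi[W]$ are defined recursively: atomic: every $\vec a\in V$ satisfies $\phi$ / no $\vec b\in W$ satisfies $\phi$; $\sim$ swaps $+$ and $-$; $\psi_1\vee_{/J}\psi_2$: $+$ on $V$ iff $+$ for $\psi_1$ on $V_1$ and for $\psi_2$ on $V_2$ for some $V=V_1\cup_JV_2$, $-$ on $W$ iff both $\psi_i$ are $-$ on $W$; $(\exists v_n/J)\psi$: $+$ on $V$ iff $\psi$ is $+$ on $V(n:f)$ for some $f:V\to A$ independent of $J$, $-$ on $W$ iff $\psi$ is $-$ on $W(n:A)$. The meaning is $\|\phi\|_{\mathfrak A}=\langle\{V:\mathfrak A\models^+\phi[V]\},\{W:\mathfrak A\models^-\phi[W]\}\rangle$.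 $\mathrm{Cs}_{\mathrm{IFG}_N}(\mathfrak A)$ is the set of meanings of all IFG$_N$-formulas in the signature of $\mathfrak A$, as a subalgebra of the IFG-cylindric power set algebra with base set $A$ and dimension $N$. A congruence is an equivalence relation preserved by all operations. An algebra is simple if its only congruences are the identity relation and the total relation, and hereditarily simple if all of its subalgebras are simple. -}

module Defs where

open import Data.Fin using (Fin; zero; suc)
open import Data.Fin.Subset using (Subset; _∈_; _∉_; _∪_; _∩_)
import Data.Fin.Subset as Sub
open import Data.Product using (Σ; _×_; _,_; ∃; ∃-syntax)
open import Data.Unit using (⊤)
open import Relation.Nullary using (¬_)
open import Relation.Binary.PropositionalEquality using (_≡_)
open import Function.Bundles using (_⇔_)

-- Fixed data: base set A = {0,1,2} = Fin 3, dimension N = 1.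
-- Following the paper's convention, a valuation in ^1 A is identified
-- with an element of A, so a team is a subset of A.

A : Set
A = Fin 3

Team : Set
Team = Subset 3

Idx : Set
Idx = Subset 1

-- a ≈_J b : a and b agree on N \ J (here N = {0}).
_≈[_]_ : A → Idx → A → Set
a ≈[ J ] b = zero ∉ J → a ≡ b

ClosedIn : Idx → Team → Team → Set
ClosedIn J V W = ∀ a b → a ∈ V → b ∈ V → a ≈[ J ] b → a ∈ W → b ∈ W

Split : Idx → Team → Team → Team → Set
Split J V V₁ V₂ =
  (V₁ ∪ V₂ ≡ V) × (V₁ ∩ V₂ ≡ Sub.⊥) × ClosedIn J V V₁ × ClosedIn J V V₂

-- f : V → A independent of J (f given as a total function; only its
-- values on V matter)
Indep : Idx → Team → (A → A) → Set
Indep J V f = ∀ a b → a ∈ V → b ∈ V → a ≈[ J ] b → f a ≡ f b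

-- U = V(0 : f) = { a(0 : f a) : a ∈ V } = { f a : a ∈ V }
IsUpdate : Team → (A → A) → Team → Set
IsUpdate V f U = ∀ c → c ∈ U ⇔ (∃[ a ] (a ∈ V × f a ≡ c))

-- U = W(0 : A) = { a(0 : b) : a ∈ W, b ∈ A } = { b : a ∈ W, b ∈ A }
IsCylUpdate : Team → Team → Set
IsCylUpdate W U = ∀ c → c ∈ U ⇔ (∃[ a ] (a ∈ W × ∃[ b ] (b ≡ c)))

-- The IFG-cylindric power set algebra with base set Fin 3, dimension 1.
-- An element X = ⟨X⁺ , X⁻⟩ with X⁺ , X⁻ ⊆ P(^1 A), given as predicates.

record Elem : Set₁ where
  constructor ⟨_,_⟩
  field
    pos : Team → Set
    neg : Team → Set
open Elem public

_≈_ : Elem → Elem → Set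
X ≈ Y = (∀ V → pos X V ⇔ pos Y V) × (∀ V → neg X V ⇔ neg Y V)

𝟘 : Elem
𝟘 = ⟨ (λ V → V ≡ Sub.⊥) , (λ V → ⊤) ⟩

𝟙 : Elem
𝟙 = ⟨ (λ V → ⊤) , (λ V → V ≡ Sub.⊥) ⟩

-- D_{00} = ⟨ P({a : a₀ = a₀}) , P({a : a₀ ≠ a₀}) ⟩  (the only D_ij for N = 1)
D₀₀ : Elem
D₀₀ = ⟨ (λ V → ∀ a → a ∈ V → a ≡ a) , (λ V → ∀ a → a ∈ V → ¬ (a ≡ a)) ⟩

¬ₑ : Elem → Elem
¬ₑ X = ⟨ neg X , pos X ⟩

plus : Idx → Elem → Elem → Elem
plus J X Y =
  ⟨ (λ V → ∃[ V₁ ] ∃[ V₂ ] (Split J V V₁ V₂ × pos X V₁ × pos Y V₂))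
  , (λ W → neg X W × neg Y W) ⟩

times : Idx → Elem → Elem → Elem
times J X Y =
  ⟨ (λ V → pos X V × pos Y V)
  , (λ W → ∃[ W₁ ] ∃[ W₂ ] (Split J W W₁ W₂ × neg X W₁ × neg Y W₂)) ⟩

cyl : Fin 1 → Idx → Elem → Elem
cyl n J X =
  ⟨ (λ V → ∃[ f ] (Indep J V f × ∃[ U ] (IsUpdate V f U × pos X U)))
  , (λ W → ∃[ U ] (IsCylUpdate W U × neg X U)) ⟩

-- IFG₁-formulas in the signature of the structure 𝟑: three constant
-- symbols c₀ , c₁ , c₂ (interpreted as 0, 1, 2) and equality.

data Term : Set where
  var : Fin 1 → Term
  con : Fin 3 → Term

data Formula : Set where
  _≐_  : Term → Term → Formula
  ∼_   : Formula → Formula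
  _∨/[_]_ : Formula → Idx → Formula → Formula
  ∃v[_]/[_]_ : Fin 1 → Idx → Formula → Formula

⟦_⟧ : Term → A → A
⟦ var _ ⟧ a = a
⟦ con k ⟧ a = k

mutual
  Sat⁺ : Formula → Team → Set
  Sat⁺ (t ≐ u) V = ∀ a → a ∈ V → ⟦ t ⟧ a ≡ ⟦ u ⟧ a
  Sat⁺ (∼ φ) V = Sat⁻ φ V
  Sat⁺ (φ ∨/[ J ] ψ) V = ∃[ V₁ ] ∃[ V₂ ] (Split J V V₁ V₂ × Sat⁺ φ V₁ × Sat⁺ ψ V₂)
  Sat⁺ (∃v[ n ]/[ J ] φ) V = ∃[ f ] (Indep J V f × ∃[ U ] (IsUpdate V f U × Sat⁺ φ U))

  Sat⁻ : Formula → Team → Set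
  Sat⁻ (t ≐ u) W = ∀ b → b ∈ W → ¬ (⟦ t ⟧ b ≡ ⟦ u ⟧ b)
  Sat⁻ (∼ φ) W = Sat⁺ φ W
  Sat⁻ (φ ∨/[ J ] ψ) W = Sat⁻ φ W × Sat⁻ ψ W
  Sat⁻ (∃v[ n ]/[ J ] φ) W = ∃[ U ] (IsCylUpdate W U × Sat⁻ φ U)

‖_‖ : Formula → Elem
‖ φ ‖ = ⟨ Sat⁺ φ , Sat⁻ φ ⟩

InCs : Elem → Set
InCs X = ∃[ φ ] (X ≈ ‖ φ ‖)

record IsSubalgebra (S : Elem → Set) : Set₁ where
  field
    inCs    : ∀ X → S X → InCs X
    has𝟘    : S 𝟘
    has𝟙    : S 𝟙
    hasD₀₀  : S D₀₀
    closed¬ : ∀ X → S X → S (¬ₑ X)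
    closed+ : ∀ J X Y → S X → S Y → S (plus J X Y)
    closed· : ∀ J X Y → S X → S Y → S (times J X Y)
    closedC : ∀ n J X → S X → S (cyl n J X)

record IsCongruence (S : Elem → Set) (θ : Elem → Elem → Set) : Set₁ where
  field
    refl*  : ∀ X Y → S X → S Y → X ≈ Y → θ X Y
    sym*   : ∀ X Y → S X → S Y → θ X Y → θ Y X
    trans* : ∀ X Y Z → S X → S Y → S Z → θ X Y → θ Y Z → θ X Z
    comp¬  : ∀ X Y → S X → S Y → θ X Y → θ (¬ₑ X) (¬ₑ Y)
    comp+  : ∀ J X X' Y Y' → S X → S X' → S Y → S Y' →
             θ X X' → θ Y Y' → θ (plus J X Y) (plus J X' Y')
    comp·  : ∀ J X X' Y Y' → S X → S X' → S Y → S Y' →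
             θ X X' → θ Y Y' → θ (times J X Y) (times J X' Y')
    compC  : ∀ n J X Y → S X → S Y → θ X Y → θ (cyl n J X) (cyl n J Y)

NonIdentity : (S : Elem → Set) (θ : Elem → Elem → Set) → Set₁
NonIdentity S θ = ∃[ X ] ∃[ Y ] (S X × S Y × θ X Y × ¬ (X ≈ Y))

NonTotal : (S : Elem → Set) (θ : Elem → Elem → Set) → Set₁
NonTotal S θ = ∃[ X ] ∃[ Y ] (S X × S Y × ¬ θ X Y)

module Submission where

open import Defs
open import Data.Product using (_×_; ∃; ∃-syntax; _,_; proj₁; proj₂)
open import Data.Nat using (ℕ)
import Data.Nat as Nat
open import Data.Bool using (Bool; true; false; T; not; _∧_; _∨_)
import Data.Bool as Bool
open import Data.Fin using (Fin; zero; suc; #_; _≟_)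
open import Data.Fin.Properties using (all?; any?)
open import Data.Fin.Subset using (Subset; _∪_; _∩_; ⁅_⁆)
import Data.Fin.Subset as Sub
open import Data.Fin.Subset.Properties using (_∈?_; anySubset?)
open import Data.Vec using (Vec; []; _∷_; lookup)
open import Data.Vec.Properties using (≡-dec)
import Data.Vec.Functional as Fun
open import Data.Unit using (tt)
open import Data.Empty using (⊥-elim)
open import Level using (0ℓ) renaming (suc to lsuc)
open import Relation.Unary using (Decidable)
open import Relation.Binary.Bundles using (Setoid)
open import Relation.Nullary using (Dec; yes)
open import Relation.Nullary.Decidable
  using (map′; _×-dec_; _→-dec_; ¬?; T?; isYes; toWitness; fromWitness; from-yes)
open import Relation.Binary.PropositionalEquality
  using (_≡_; _≢_; _≗_; refl; sym; trans; cong)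
open import Function.Base using (_∘_)
open import Function.Bundles using (_⇔_; mk⇔; Equivalence)
import Function.Properties.Equivalence as ⇔

open Equivalence using (to; from)

-- The subalgebra is spanned by seven elements, which we describe by finite
-- codes (characteristic functions of X⁺ and X⁻ on the eight teams of 3):
--   𝟙 , 𝟘 , Ω = ⟨{∅},{∅}⟩ , Q = ⟨P{0,1},{∅}⟩ , Q' = ⟨{V ⊆ {0,1} : |V| ≤ 1},{∅}⟩
-- and the complements ¬Q , ¬Q'.  The relation identifying Q with Q' and ¬Q
-- with ¬Q' (and nothing else) is a congruence, which is neither the identity
-- nor the total relation.

≈-refl : ∀ {X} → X ≈ X
≈-refl = (λ _ → ⇔.refl) , (λ _ → ⇔.refl)

≈-sym : ∀ {X Y} → X ≈ Y → Y ≈ X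
≈-sym (p , n) = (λ V → ⇔.sym (p V)) , (λ V → ⇔.sym (n V))

≈-trans : ∀ {X Y Z} → X ≈ Y → Y ≈ Z → X ≈ Z
≈-trans (p , n) (p' , n') = (λ V → ⇔.trans (p V) (p' V)) , (λ V → ⇔.trans (n V) (n' V))

≈-setoid : Setoid (lsuc 0ℓ) 0ℓ
≈-setoid = record
  { Carrier = Elem ; _≈_ = _≈_
  ; isEquivalence = record { refl = ≈-refl ; sym = ≈-sym ; trans = ≈-trans } }

open import Relation.Binary.Reasoning.Setoid ≈-setoid

¬-resp : ∀ {X Y} → X ≈ Y → ¬ₑ X ≈ ¬ₑ Y
¬-resp (p , n) = n , p

∃split-resp : ∀ {J} {P P' Q Q' : Team → Set} →
  (∀ V → P V ⇔ P' V) → (∀ V → Q V ⇔ Q' V) → ∀ V →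
  (∃[ V₁ ] ∃[ V₂ ] (Split J V V₁ V₂ × P V₁ × Q V₂)) ⇔
  (∃[ V₁ ] ∃[ V₂ ] (Split J V V₁ V₂ × P' V₁ × Q' V₂))
∃split-resp p q V =
  mk⇔ (λ (V₁ , V₂ , s , a , b) → V₁ , V₂ , s , to (p V₁) a , to (q V₂) b)
      (λ (V₁ , V₂ , s , a , b) → V₁ , V₂ , s , from (p V₁) a , from (q V₂) b)

×-resp : ∀ {P P' Q Q' : Team → Set} →
  (∀ V → P V ⇔ P' V) → (∀ V → Q V ⇔ Q' V) → ∀ V → (P V × Q V) ⇔ (P' V × Q' V)
×-resp p q V = mk⇔ (λ (a , b) → to (p V) a , to (q V) b) (λ (a , b) → from (p V) a , from (q V) b)

plus-resp : ∀ J {X X' Y Y'} → X ≈ X' → Y ≈ Y' → plus J X Y ≈ plus J X' Y'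
plus-resp J (px , nx) (py , ny) = ∃split-resp px py , ×-resp nx ny

times-resp : ∀ J {X X' Y Y'} → X ≈ X' → Y ≈ Y' → times J X Y ≈ times J X' Y'
times-resp J (px , nx) (py , ny) = ×-resp px py , ∃split-resp nx ny

cyl-resp : ∀ n J {X Y} → X ≈ Y → cyl n J X ≈ cyl n J Y
cyl-resp n J (p , q) =
  (λ V → mk⇔ (λ (f , i , U , u , a) → f , i , U , u , to (p U) a)
             (λ (f , i , U , u , a) → f , i , U , u , from (p U) a))
  , (λ W → mk⇔ (λ (U , u , a) → U , u , to (q U) a) (λ (U , u , a) → U , u , from (q U) a))

_⇔?_ : ∀ {P Q : Set} → Dec P → Dec Q → Dec (P ⇔ Q)
p? ⇔? q? = map′ (λ (f , g) → mk⇔ f g) (λ e → to e , from e) ((p? →-dec q?) ×-dec (q? →-dec p?))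

_≟ˢ_ : ∀ {n} (V W : Subset n) → Dec (V ≡ W)
_≟ˢ_ = ≡-dec Bool._≟_

allSubset? : ∀ {n} {P : Subset n → Set} → Decidable P → Dec (∀ V → P V)
allSubset? {Nat.zero} P? = map′ (λ p → λ { [] → p }) (λ h → h []) (P? [])
allSubset? {Nat.suc n} P? =
  map′ (λ (p , q) → λ { (true ∷ V) → p V ; (false ∷ V) → q V })
       (λ h → (h ∘ (true ∷_)) , (h ∘ (false ∷_)))
       (allSubset? (P? ∘ (true ∷_)) ×-dec allSubset? (P? ∘ (false ∷_)))

-- An extensional property of functions Fin m → Fin n has decidable
-- existence: such a function is determined by its head and its tail.
anyFunction? : ∀ {m n} {P : (Fin m → Fin n) → Set} →
  (∀ {f g} → f ≗ g → P f → P g) → Decidable P → Dec (∃ P)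
anyFunction? {Nat.zero} resp P? =
  map′ (λ p → fromFin0 , p) (λ (f , p) → resp (λ ()) p) (P? fromFin0)
  where
    fromFin0 : Fin 0 → Fin _
    fromFin0 ()
anyFunction? {Nat.suc m} resp P? =
  map′ (λ (a , g , p) → a Fun.∷ g , p)
       (λ (f , p) → f zero , f ∘ suc , resp head∷tail p)
       (any? λ a → anyFunction? (resp ∘ cons-resp a) (λ g → P? (a Fun.∷ g)))
  where
    head∷tail : ∀ {f : Fin (Nat.suc m) → Fin _} → f ≗ (f zero Fun.∷ f ∘ suc)
    head∷tail zero = refl
    head∷tail (suc i) = refl
    cons-resp : ∀ a {f g : Fin m → Fin _} → f ≗ g → (a Fun.∷ f) ≗ (a Fun.∷ g)
    cons-resp a eq zero = refl
    cons-resp a eq (suc i) = eq i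

DecElem : Elem → Set
DecElem X = Decidable (pos X) × Decidable (neg X)

record Code : Set where
  constructor code
  field
    pos? neg? : Team → Bool
open Code

decode : Code → Elem
decode c = ⟨ (λ V → T (pos? c V)) , (λ W → T (neg? c W)) ⟩

encode : ∀ X → DecElem X → Code
encode X (X⁺? , X⁻?) = code (λ V → isYes (X⁺? V)) (λ W → isYes (X⁻? W))

decode-dec : ∀ c → DecElem (decode c)
decode-dec c = (λ V → T? (pos? c V)) , (λ W → T? (neg? c W))

decode-encode : ∀ X (d : DecElem X) → decode (encode X d) ≈ X
decode-encode X _ = (λ V → mk⇔ toWitness fromWitness) , (λ W → mk⇔ toWitness fromWitness)

_≗ᶜ_ : Code → Code → Set
c ≗ᶜ d = ∀ V → (pos? c V ≡ pos? d V) × (neg? c V ≡ neg? d V)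

_≗ᶜ?_ : ∀ c d → Dec (c ≗ᶜ d)
c ≗ᶜ? d = allSubset? λ V → (pos? c V Bool.≟ pos? d V) ×-dec (neg? c V Bool.≟ neg? d V)

≗ᶜ⇒≈ : ∀ {c d} → c ≗ᶜ d → decode c ≈ decode d
≗ᶜ⇒≈ eq = (λ V → T-cong (proj₁ (eq V))) , (λ V → T-cong (proj₂ (eq V)))
  where
    T-cong : ∀ {a b} → a ≡ b → T a ⇔ T b
    T-cong refl = ⇔.refl

≈⇒≗ᶜ : ∀ {c d} → decode c ≈ decode d → c ≗ᶜ d
≈⇒≗ᶜ (p , n) V = T-injective (p V) , T-injective (n V)
  where
    T-injective : ∀ {a b} → T a ⇔ T b → a ≡ b
    T-injective {true}  {true}  e = refl
    T-injective {true}  {false} e = ⊥-elim (to e tt)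
    T-injective {false} {true}  e = ⊥-elim (from e tt)
    T-injective {false} {false} e = refl

-- A decidable element equals a decoded code as soon as its own code agrees
-- with it pointwise; this reduces ≈ to a finite computation.
≈-by-code : ∀ X (d : DecElem X) c → encode X d ≗ᶜ c → X ≈ decode c
≈-by-code X d c eq = ≈-trans (≈-sym (decode-encode X d)) (≗ᶜ⇒≈ eq)

_≈[_]?_ : ∀ a J b → Dec (a ≈[ J ] b)
a ≈[ J ]? b = ¬? (zero ∈? J) →-dec (a ≟ b)

closedIn? : ∀ J V W → Dec (ClosedIn J V W)
closedIn? J V W = all? λ a → all? λ b →
  (a ∈? V) →-dec ((b ∈? V) →-dec ((a ≈[ J ]? b) →-dec ((a ∈? W) →-dec (b ∈? W))))

split? : ∀ J V V₁ V₂ → Dec (Split J V V₁ V₂)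
split? J V V₁ V₂ =
  ((V₁ ∪ V₂) ≟ˢ V) ×-dec ((V₁ ∩ V₂) ≟ˢ Sub.⊥) ×-dec closedIn? J V V₁ ×-dec closedIn? J V V₂

indep? : ∀ J V f → Dec (Indep J V f)
indep? J V f = all? λ a → all? λ b →
  (a ∈? V) →-dec ((b ∈? V) →-dec ((a ≈[ J ]? b) →-dec (f a ≟ f b)))

isUpdate? : ∀ V f U → Dec (IsUpdate V f U)
isUpdate? V f U = all? λ c → (c ∈? U) ⇔? (any? λ a → (a ∈? V) ×-dec (f a ≟ c))

isCylUpdate? : ∀ W U → Dec (IsCylUpdate W U)
isCylUpdate? W U = all? λ c → (c ∈? U) ⇔? (any? λ a → (a ∈? W) ×-dec yes (c , refl))

indep-resp : ∀ {J V f g} → f ≗ g → Indep J V f → Indep J V g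
indep-resp eq ind a b a∈V b∈V a≈b = trans (sym (eq a)) (trans (ind a b a∈V b∈V a≈b) (eq b))

isUpdate-resp : ∀ {V f g U} → f ≗ g → IsUpdate V f U → IsUpdate V g U
isUpdate-resp eq u c =
  mk⇔ (λ c∈U → let (a , a∈V , fa≡c) = to (u c) c∈U in a , a∈V , trans (sym (eq a)) fa≡c)
      (λ (a , a∈V , ga≡c) → from (u c) (a , a∈V , trans (eq a) ga≡c))

¬-dec : ∀ {X} → DecElem X → DecElem (¬ₑ X)
¬-dec (X⁺? , X⁻?) = X⁻? , X⁺?

plus-dec : ∀ J {X Y} → DecElem X → DecElem Y → DecElem (plus J X Y)
plus-dec J (X⁺? , X⁻?) (Y⁺? , Y⁻?) =
  (λ V → anySubset? λ V₁ → anySubset? λ V₂ → split? J V V₁ V₂ ×-dec X⁺? V₁ ×-dec Y⁺? V₂)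
  , (λ W → X⁻? W ×-dec Y⁻? W)

times-dec : ∀ J {X Y} → DecElem X → DecElem Y → DecElem (times J X Y)
times-dec J (X⁺? , X⁻?) (Y⁺? , Y⁻?) =
  (λ V → X⁺? V ×-dec Y⁺? V)
  , (λ W → anySubset? λ W₁ → anySubset? λ W₂ → split? J W W₁ W₂ ×-dec X⁻? W₁ ×-dec Y⁻? W₂)

cyl-dec : ∀ n J {X} → DecElem X → DecElem (cyl n J X)
cyl-dec n J (X⁺? , X⁻?) =
  (λ V → anyFunction? (λ eq (ind , U , u , x) → indep-resp eq ind , U , isUpdate-resp eq u , x)
           (λ f → indep? J V f ×-dec anySubset? λ U → isUpdate? V f U ×-dec X⁺? U))
  , (λ W → anySubset? λ U → isCylUpdate? W U ×-dec X⁻? U)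

atom-dec : ∀ t u → DecElem ‖ t ≐ u ‖
atom-dec t u =
  (λ V → all? λ a → (a ∈? V) →-dec (⟦ t ⟧ a ≟ ⟦ u ⟧ a))
  , (λ W → all? λ b → (b ∈? W) →-dec ¬? (⟦ t ⟧ b ≟ ⟦ u ⟧ b))

meaning-dec : ∀ φ → DecElem ‖ φ ‖
meaning-dec (t ≐ u) = atom-dec t u
meaning-dec (∼ φ) = ¬-dec (meaning-dec φ)
meaning-dec (φ ∨/[ J ] ψ) = plus-dec J (meaning-dec φ) (meaning-dec ψ)
meaning-dec (∃v[ n ]/[ J ] φ) = cyl-dec n J (meaning-dec φ)

record FiniteSubalgebra (k : ℕ) : Set₁ where
  field
    element   : Fin k → Elem
    formula   : Fin k → Formula
    realized  : ∀ i → element i ≈ ‖ formula i ‖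
    distinct  : ∀ i j → element i ≈ element j → i ≡ j
    𝟘-index   : ∃[ i ] (𝟘 ≈ element i)
    𝟙-index   : ∃[ i ] (𝟙 ≈ element i)
    D₀₀-index : ∃[ i ] (D₀₀ ≈ element i)
    negT      : Fin k → Fin k
    plusT     : Idx → Fin k → Fin k → Fin k
    timesT    : Idx → Fin k → Fin k → Fin k
    cylT      : Idx → Fin k → Fin k
    negT-ok   : ∀ i → ¬ₑ (element i) ≈ element (negT i)
    plusT-ok  : ∀ J i j → plus J (element i) (element j) ≈ element (plusT J i j)
    timesT-ok : ∀ J i j → times J (element i) (element j) ≈ element (timesT J i j)
    cylT-ok   : ∀ n J i → cyl n J (element i) ≈ element (cylT J i)

module _ {k} (𝒮 : FiniteSubalgebra k) where
  open FiniteSubalgebra 𝒮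

  Member : Elem → Set
  Member X = ∃[ i ] (X ≈ element i)

  index-unique : ∀ {X i j} → X ≈ element i → X ≈ element j → i ≡ j
  index-unique e f = distinct _ _ (≈-trans (≈-sym e) f)

  ¬-member : ∀ {X i} → X ≈ element i → ¬ₑ X ≈ element (negT i)
  ¬-member e = ≈-trans (¬-resp e) (negT-ok _)

  plus-member : ∀ J {X Y i j} → X ≈ element i → Y ≈ element j →
                plus J X Y ≈ element (plusT J i j)
  plus-member J {X} {Y} {i} {j} e f = begin
    plus J X Y                    ≈⟨ plus-resp J e f ⟩
    plus J (element i) (element j) ≈⟨ plusT-ok J i j ⟩
    element (plusT J i j)         ∎

  times-member : ∀ J {X Y i j} → X ≈ element i → Y ≈ element j →
                 times J X Y ≈ element (timesT J i j)
  times-member J {X} {Y} {i} {j} e f = begin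
    times J X Y                     ≈⟨ times-resp J e f ⟩
    times J (element i) (element j) ≈⟨ timesT-ok J i j ⟩
    element (timesT J i j)          ∎

  cyl-member : ∀ n J {X i} → X ≈ element i → cyl n J X ≈ element (cylT J i)
  cyl-member n J {X} {i} e = begin
    cyl n J X           ≈⟨ cyl-resp n J e ⟩
    cyl n J (element i) ≈⟨ cylT-ok n J i ⟩
    element (cylT J i)  ∎

  isSubalgebra : IsSubalgebra Member
  isSubalgebra = record
    { inCs    = λ X (i , e) → formula i , ≈-trans e (realized i)
    ; has𝟘    = 𝟘-index
    ; has𝟙    = 𝟙-index
    ; hasD₀₀  = D₀₀-index
    ; closed¬ = λ X (i , e) → negT i , ¬-member e
    ; closed+ = λ J X Y (i , e) (j , f) → plusT J i j , plus-member J e f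
    ; closed· = λ J X Y (i , e) (j , f) → timesT J i j , times-member J e f
    ; closedC = λ n J X (i , e) → cylT J i , cyl-member n J e
    }

  record Compatible {m} (cls : Fin k → Fin m) : Set where
    field
      neg-compat   : ∀ i j → cls i ≡ cls j → cls (negT i) ≡ cls (negT j)
      plus-compat  : ∀ J i i' j j' → cls i ≡ cls i' → cls j ≡ cls j' →
                     cls (plusT J i j) ≡ cls (plusT J i' j')
      times-compat : ∀ J i i' j j' → cls i ≡ cls i' → cls j ≡ cls j' →
                     cls (timesT J i j) ≡ cls (timesT J i' j')
      cyl-compat   : ∀ J i j → cls i ≡ cls j → cls (cylT J i) ≡ cls (cylT J j)

  Kernel : ∀ {m} → (Fin k → Fin m) → Elem → Elem → Set
  Kernel cls X Y = ∃[ i ] ∃[ j ] (X ≈ element i × Y ≈ element j × cls i ≡ cls j)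

  kernel-congruence : ∀ {m} {cls : Fin k → Fin m} → Compatible cls →
                      IsCongruence Member (Kernel cls)
  kernel-congruence {cls = cls} compat = record
    { refl*  = λ X Y (i , e) (j , f) X≈Y →
                 i , j , e , f , cong cls (index-unique (≈-trans (≈-sym X≈Y) e) f)
    ; sym*   = λ X Y _ _ (i , j , e , f , c) → j , i , f , e , sym c
    ; trans* = λ X Y Z _ _ _ (i , j , e , f , c) (j' , l , f' , g , c') →
                 i , l , e , g , trans c (trans (cong cls (index-unique f f')) c')
    ; comp¬  = λ X Y _ _ (i , j , e , f , c) →
                 negT i , negT j , ¬-member e , ¬-member f , neg-compat i j c
    ; comp+  = λ J X X' Y Y' _ _ _ _ (i , i' , e , e' , c) (j , j' , f , f' , d) →
                 plusT J i j , plusT J i' j' , plus-member J e f , plus-member J e' f'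
                 , plus-compat J i i' j j' c d
    ; comp·  = λ J X X' Y Y' _ _ _ _ (i , i' , e , e' , c) (j , j' , f , f' , d) →
                 timesT J i j , timesT J i' j' , times-member J e f , times-member J e' f'
                 , times-compat J i i' j j' c d
    ; compC  = λ n J X Y _ _ (i , j , e , f , c) →
                 cylT J i , cylT J j , cyl-member n J e , cyl-member n J f , cyl-compat J i j c
    }
    where open Compatible compat

  kernel-nonIdentity : ∀ {m} {cls : Fin k → Fin m} i j → i ≢ j → cls i ≡ cls j →
                       NonIdentity Member (Kernel cls)
  kernel-nonIdentity i j i≢j c =
    element i , element j , (i , ≈-refl) , (j , ≈-refl) , (i , j , ≈-refl , ≈-refl , c)
    , λ e → i≢j (distinct i j e)

  kernel-nonTotal : ∀ {m} {cls : Fin k → Fin m} i j → cls i ≢ cls j →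
                    NonTotal Member (Kernel cls)
  kernel-nonTotal {cls = cls} i j c≢ =
    element i , element j , (i , ≈-refl) , (j , ≈-refl)
    , λ (i' , j' , e , f , c) →
        c≢ (trans (cong cls (index-unique ≈-refl e))
                  (trans c (cong cls (index-unique f ≈-refl))))

-- Characteristic functions of the sets of teams V = (0 ∈ V , 1 ∈ V , 2 ∈ V)
-- with V = ∅, with V ⊆ {0,1}, with V ⊆ {0,1} and |V| ≤ 1, and of all teams.
isEmpty within01 atMostOne01 every : Team → Bool
isEmpty     (a ∷ b ∷ c ∷ []) = not (a ∨ b ∨ c)
within01    (a ∷ b ∷ c ∷ []) = not c
atMostOne01 (a ∷ b ∷ c ∷ []) = not c ∧ not (a ∧ b)
every       _                = true

-- The elements 𝟙 , 𝟘 , ¬Q , Q , Ω , ¬Q' , Q' (indices 0 … 6), where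
-- Q = ⟨P{0,1},{∅}⟩, Q' = ⟨{V ⊆ {0,1} : |V| ≤ 1},{∅}⟩ and Ω = ⟨{∅},{∅}⟩.
codes : Vec Code 7
codes = code every isEmpty
      ∷ code isEmpty every
      ∷ code isEmpty within01
      ∷ code within01 isEmpty
      ∷ code isEmpty isEmpty
      ∷ code isEmpty atMostOne01
      ∷ code atMostOne01 isEmpty
      ∷ []

∅ᴶ ⁅0⁆ᴶ : Idx
∅ᴶ = Sub.⊥
⁅0⁆ᴶ = ⁅ zero ⁆

v₀=c : Fin 3 → Formula
v₀=c k = var zero ≐ con k

-- Defining formulas: c₀ = c₀ means 𝟙 and Ω says "v₀ = c₀ ∨/{0} v₀ ≠ c₀" fails,
-- i.e. is undetermined.  In Q' the disjunction ∨/{0} cannot split a team, so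
-- the team must lie entirely in {0} or in {1}; the disjunct Ω contributes
-- only the empty team.
Tf Ωf Qf Q'f : Formula
Tf  = con zero ≐ con zero
Ωf  = ∃v[ zero ]/[ ∅ᴶ ] (∼ (v₀=c zero ∨/[ ⁅0⁆ᴶ ] (∼ v₀=c zero)))
Qf  = (v₀=c zero ∨/[ ∅ᴶ ] v₀=c (# 1)) ∨/[ ∅ᴶ ] Ωf
Q'f = (v₀=c zero ∨/[ ⁅0⁆ᴶ ] v₀=c (# 1)) ∨/[ ∅ᴶ ] Ωf

formulas : Vec Formula 7
formulas = Tf ∷ ∼ Tf ∷ ∼ Qf ∷ Qf ∷ Ωf ∷ ∼ Q'f ∷ Q'f ∷ []

-- Only
-- the parameter J = ∅ or J = {0} matters; the two plus tables differ only at
-- Q' + Q', the two times tables only at ¬Q' · ¬Q', and C_{0,J} does not depend on J.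
negTable : Vec (Fin 7) 7
negTable = # 1 ∷ # 0 ∷ # 3 ∷ # 2 ∷ # 4 ∷ # 6 ∷ # 5 ∷ []

Table : Set
Table = Vec (Vec (Fin 7) 7) 7

plusTable : Fin 7 → Table
plusTable q'+q' =
    (# 0 ∷ # 0 ∷ # 0 ∷ # 0 ∷ # 0 ∷ # 0 ∷ # 0 ∷ [])
  ∷ (# 0 ∷ # 1 ∷ # 2 ∷ # 3 ∷ # 4 ∷ # 5 ∷ # 6 ∷ [])
  ∷ (# 0 ∷ # 2 ∷ # 2 ∷ # 3 ∷ # 4 ∷ # 5 ∷ # 6 ∷ [])
  ∷ (# 0 ∷ # 3 ∷ # 3 ∷ # 3 ∷ # 3 ∷ # 3 ∷ # 3 ∷ [])
  ∷ (# 0 ∷ # 4 ∷ # 4 ∷ # 3 ∷ # 4 ∷ # 4 ∷ # 6 ∷ [])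
  ∷ (# 0 ∷ # 5 ∷ # 5 ∷ # 3 ∷ # 4 ∷ # 5 ∷ # 6 ∷ [])
  ∷ (# 0 ∷ # 6 ∷ # 6 ∷ # 3 ∷ # 6 ∷ # 6 ∷ q'+q' ∷ [])
  ∷ []

timesTable : Fin 7 → Table
timesTable ¬q'·¬q' =
    (# 0 ∷ # 1 ∷ # 2 ∷ # 3 ∷ # 4 ∷ # 5 ∷ # 6 ∷ [])
  ∷ (# 1 ∷ # 1 ∷ # 1 ∷ # 1 ∷ # 1 ∷ # 1 ∷ # 1 ∷ [])
  ∷ (# 2 ∷ # 1 ∷ # 2 ∷ # 2 ∷ # 2 ∷ # 2 ∷ # 2 ∷ [])
  ∷ (# 3 ∷ # 1 ∷ # 2 ∷ # 3 ∷ # 4 ∷ # 5 ∷ # 6 ∷ [])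
  ∷ (# 4 ∷ # 1 ∷ # 2 ∷ # 4 ∷ # 4 ∷ # 5 ∷ # 4 ∷ [])
  ∷ (# 5 ∷ # 1 ∷ # 2 ∷ # 5 ∷ # 5 ∷ ¬q'·¬q' ∷ # 5 ∷ [])
  ∷ (# 6 ∷ # 1 ∷ # 2 ∷ # 6 ∷ # 4 ∷ # 5 ∷ # 6 ∷ [])
  ∷ []

cylTable : Vec (Fin 7) 7
cylTable = # 0 ∷ # 1 ∷ # 4 ∷ # 0 ∷ # 4 ∷ # 4 ∷ # 0 ∷ []

-- Select by J ∈ {∅, {0}}: for J = ∅ a split V₁ ∪_J V₂ is arbitrary, for
-- J = {0} one of the parts is empty.
byJ : {B : Set} → Idx → B → B → B
byJ (false ∷ []) b∅ b₀ = b∅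
byJ (true ∷ [])  b∅ b₀ = b₀

negT : Fin 7 → Fin 7
negT i = lookup negTable i

plusT timesT : Idx → Fin 7 → Fin 7 → Fin 7
plusT J i j = lookup (lookup (plusTable (byJ J (# 3) (# 6))) i) j
timesT J i j = lookup (lookup (timesTable (byJ J (# 2) (# 5))) i) j

cylT : Idx → Fin 7 → Fin 7
cylT J i = lookup cylTable i

element : Fin 7 → Elem
element i = decode (lookup codes i)

element-dec : ∀ i → DecElem (element i)
element-dec i = decode-dec (lookup codes i)

negT-ok : ∀ i → ¬ₑ (element i) ≈ element (negT i)
negT-ok i = ≈-by-code _ (¬-dec (element-dec i)) _ (check i)
  where
    check : ∀ i → encode _ (¬-dec (element-dec i)) ≗ᶜ lookup codes (negT i)
    check = from-yes (all? λ i →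
      encode _ (¬-dec (element-dec i)) ≗ᶜ? lookup codes (negT i))

plusT-ok : ∀ J i j → plus J (element i) (element j) ≈ element (plusT J i j)
plusT-ok J i j = ≈-by-code _ (plus-dec J (element-dec i) (element-dec j)) _ (check J i j)
  where
    check : ∀ J i j → encode _ (plus-dec J (element-dec i) (element-dec j))
                        ≗ᶜ lookup codes (plusT J i j)
    check = from-yes (allSubset? λ J → all? λ i → all? λ j →
      encode _ (plus-dec J (element-dec i) (element-dec j)) ≗ᶜ? lookup codes (plusT J i j))

timesT-ok : ∀ J i j → times J (element i) (element j) ≈ element (timesT J i j)
timesT-ok J i j = ≈-by-code _ (times-dec J (element-dec i) (element-dec j)) _ (check J i j)
  where
    check : ∀ J i j → encode _ (times-dec J (element-dec i) (element-dec j))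
                        ≗ᶜ lookup codes (timesT J i j)
    check = from-yes (allSubset? λ J → all? λ i → all? λ j →
      encode _ (times-dec J (element-dec i) (element-dec j)) ≗ᶜ? lookup codes (timesT J i j))

cylT-ok : ∀ n J i → cyl n J (element i) ≈ element (cylT J i)
cylT-ok n J i = ≈-by-code _ (cyl-dec n J (element-dec i)) _ (check n J i)
  where
    check : ∀ n J i → encode _ (cyl-dec n J (element-dec i)) ≗ᶜ lookup codes (cylT J i)
    check = from-yes (all? λ n → allSubset? λ J → all? λ i →
      encode _ (cyl-dec n J (element-dec i)) ≗ᶜ? lookup codes (cylT J i))

distinct : ∀ i j → element i ≈ element j → i ≡ j
distinct i j e = check i j (≈⇒≗ᶜ e)
  where
    check : ∀ i j → lookup codes i ≗ᶜ lookup codes j → i ≡ j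
    check = from-yes (all? λ i → all? λ j → (lookup codes i ≗ᶜ? lookup codes j) →-dec (i ≟ j))

realized : ∀ i → element i ≈ ‖ lookup formulas i ‖
realized i = ≈-sym (≈-by-code _ (meaning-dec (lookup formulas i)) _ (check i))
  where
    check : ∀ i → encode _ (meaning-dec (lookup formulas i)) ≗ᶜ lookup codes i
    check = from-yes (all? λ i → encode _ (meaning-dec (lookup formulas i)) ≗ᶜ? lookup codes i)

-- The constants are decidable and appear as 𝟘 = element 1, 𝟙 = D₀₀ = element 0.
𝟘-dec : DecElem 𝟘
𝟘-dec = (_≟ˢ Sub.⊥) , (λ _ → yes tt)

𝟙-dec : DecElem 𝟙
𝟙-dec = (λ _ → yes tt) , (_≟ˢ Sub.⊥)

D₀₀-dec : DecElem D₀₀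
D₀₀-dec = (λ V → all? λ a → (a ∈? V) →-dec (a ≟ a))
        , (λ W → all? λ a → (a ∈? W) →-dec ¬? (a ≟ a))

sevenElements : FiniteSubalgebra 7
sevenElements = record
  { element   = element
  ; formula   = lookup formulas
  ; realized  = realized
  ; distinct  = distinct
  ; 𝟘-index   = # 1 , ≈-by-code 𝟘 𝟘-dec _ (from-yes (encode 𝟘 𝟘-dec ≗ᶜ? lookup codes (# 1)))
  ; 𝟙-index   = # 0 , ≈-by-code 𝟙 𝟙-dec _ (from-yes (encode 𝟙 𝟙-dec ≗ᶜ? lookup codes (# 0)))
  ; D₀₀-index = # 0 , ≈-by-code D₀₀ D₀₀-dec _ (from-yes (encode D₀₀ D₀₀-dec ≗ᶜ? lookup codes (# 0)))
  ; negT      = negT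
  ; plusT     = plusT
  ; timesT    = timesT
  ; cylT      = cylT
  ; negT-ok   = negT-ok
  ; plusT-ok  = plusT-ok
  ; timesT-ok = timesT-ok
  ; cylT-ok   = cylT-ok
  }

-- The congruence classes: Q ~ Q' and ¬Q ~ ¬Q', all other classes singletons.
classOf : Fin 7 → Fin 5
classOf i = lookup (# 0 ∷ # 1 ∷ # 2 ∷ # 3 ∷ # 4 ∷ # 2 ∷ # 3 ∷ []) i

classOf-compatible : Compatible sevenElements classOf
classOf-compatible = record
  { neg-compat   = from-yes (all? λ i → all? λ j →
      (classOf i ≟ classOf j) →-dec (classOf (negT i) ≟ classOf (negT j)))
  ; plus-compat  = from-yes (allSubset? λ J → all? λ i → all? λ i' → all? λ j → all? λ j' →
      (classOf i ≟ classOf i') →-dec ((classOf j ≟ classOf j') →-dec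
        (classOf (plusT J i j) ≟ classOf (plusT J i' j'))))
  ; times-compat = from-yes (allSubset? λ J → all? λ i → all? λ i' → all? λ j → all? λ j' →
      (classOf i ≟ classOf i') →-dec ((classOf j ≟ classOf j') →-dec
        (classOf (timesT J i j) ≟ classOf (timesT J i' j'))))
  ; cyl-compat   = from-yes (allSubset? λ J → all? λ i → all? λ j →
      (classOf i ≟ classOf j) →-dec (classOf (cylT J i) ≟ classOf (cylT J j)))
  }

mainTheorem2 : ∃[ S ] (IsSubalgebra S × ∃[ θ ] (IsCongruence S θ × NonIdentity S θ × NonTotal S θ))
mainTheorem2 =
    Member sevenElements
  , isSubalgebra sevenElements
  , Kernel sevenElements classOf
  , kernel-congruence sevenElements classOf-compatible
  , kernel-nonIdentity sevenElements (# 3) (# 6) (λ ()) refl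
  , kernel-nonTotal sevenElements (# 0) (# 1) (λ ())
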